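{- Let $\mathcal{L}$ be a finite ranked atomic lattice and let $\mathcal{G}_1$ and $\mathcal{G}_2=\mathcal{G}_1\cup\{b\}$ with $b\notin\mathcal{G}_1$ be building sets. Write $F_b=F_{\mathcal{G}_1}(b)$. Let $S\in N(\mathcal{G}_2)$ with $b\in S$, and put $S'=(S\setminus\{b\})\cup F_b$. Let $H'\subset\mathcal{G}_1$ and $M\subset F_b$ with $H'\cap F_b=\emptyset$ and $H'\cup M\cup S\in N(\mathcal{G}_2)$. Then for every $A\in H'\cup F_b$: (1) $d^S_{(H'\cup M)_{<A},A}=d^S_{H'_{<A},A}$; (2) $d^S_{(H'\cup M\cup\{b\})_{<A},A}=d^S_{(H'\cup M)_{<A},A}$; (3) $d^{S'}_{(H'\cup M)_{<A},A}=d^{S'}_{H'_{<A},A}$; (4) $d^{S'}_{H'_{<A},A}=d^{S}_{H'_{<A},A}$; and moreover (5) $d^S_{(H'\cup M)_{<b},b}=\sum_{F\in F_b\setminus(S\cup M)}d^{S'}_{H'_{<F},F}=\sum_{F\in F_b\setminus(S\cup M)}d^{S}_{H'_{<F},F}$.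
   Context: All posets are finite. For $X\subset\mathcal{L}$, $x\in\mathcal{L}$: $X_{<x}=\{y\in X:y<x\}$; $\max X$ is the set of maximal elements; $\bigvee T$ is the join; $\hat0$ is the least element; $[a,b]=\{x:a\le x\le b\}$; products carry the componentwise order. Atoms are elements covering $\hat0$; $\mathcal{L}$ is ranked if all maximal chains from $\hat0$ to any $x$ have equal length, atomic if every element is a join of atoms. A subset $\mathcal{G}\subset\mathcal{L}\setminus\{\hat0\}$ is a building set if for every $p\ne\hat0$ there is a poset isomorphism $\phi:[\hat0,p]\to\prod_{g\in F_{\mathcal{G}}(p)}[\hat0,g]$ with $\phi(g)=(\hat0,\dots,g,\dots,\hat0)$ for all $g\in F_{\mathcal{G}}(p)$, where $F_{\mathcal{G}}(p)=\max\{g\in\mathcal{G}:g\le p\}$. $N(\mathcal{G})$ is the set of all $S\subset\mathcal{G}$ (including $\emptyset$) such that for every $T\subset S$ with $|T|\ge2$ of pairwise incomparable elements, $\bigvee T\notin\mathcal{G}$. For $S,H\subset\mathcal{L}$ and $B\in\mathcal{L}$ with $\bigvee(H\cup S_{<B})\le B$, $d^S_{H,B}$ denotes the minimal number $m\ge0$ of atoms $A_1,\dots,A_m$ such that $B=\bigvee\big(H\cup S_{<B}\cup\{A_1,\dots,A_m\}\big)$. -}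

module Defs where

open import Data.Nat using (ℕ; zero; suc; _⊓_) renaming (_≤_ to _≤ℕ_)
open import Data.Bool using (Bool; true; false; _∧_)
open import Data.Fin using (Fin)
open import Data.Fin.Properties using (_≟_; all?)
open import Data.Fin.Subset
  using (Subset; inside; outside; _∈_; _∉_; _⊆_; _∪_; ∣_∣)
open import Data.Fin.Subset.Properties using (_∈?_)
open import Data.Vec using (Vec; []; _∷_; tabulate)
import Data.List as List
open import Data.List using (List; []; _∷_; _++_)
open import Data.Nat.ListAction using (sum)
open import Data.Product using (Σ; _×_; _,_; ∃)
open import Data.Sum using (_⊎_)
open import Relation.Binary.PropositionalEquality using (_≡_; _≢_)
open import Relation.Binary.Core using (Rel)
open import Relation.Binary.Definitions using (Decidable; Minimum)
open import Relation.Binary.Lattice.Structures using (IsLattice)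
open import Relation.Nullary using (¬_; Dec; yes; no; does)
open import Relation.Nullary.Decidable using (_×-dec_; ¬?; _→-dec_)

record FinLattice : Set₁ where
  field
    n          : ℕ
    _≤_        : Rel (Fin n) _
    _≤?_       : Decidable _≤_
    _∨_        : Fin n → Fin n → Fin n
    _∧ₗ_       : Fin n → Fin n → Fin n
    isLattice  : IsLattice _≡_ _≤_ _∨_ _∧ₗ_
    𝟘          : Fin n
    𝟘-minimum  : Minimum _≤_ 𝟘

module _ (L : FinLattice) where
  open FinLattice L

  _<_ : Fin n → Fin n → Set
  x < y = x ≤ y × x ≢ y

  _<?_ : Decidable _<_
  x <? y = (x ≤? y) ×-dec ¬? (x ≟ y)

  _⋖_ : Fin n → Fin n → Set
  x ⋖ y = x < y × (∀ z → x < z → ¬ (z < y))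

  IsAtom : Fin n → Set
  IsAtom a = 𝟘 ⋖ a

  isAtom? : (a : Fin n) → Dec (IsAtom a)
  isAtom? a = (𝟘 <? a) ×-dec all? (λ z → (𝟘 <? z) →-dec ¬? (z <? a))

  data SatChain : Fin n → Fin n → ℕ → Set where
    here : ∀ {x} → SatChain x x zero
    step : ∀ {x y z k} → x ⋖ y → SatChain y z k → SatChain x z (suc k)

  Ranked : Set
  Ranked = ∀ x {k₁ k₂} → SatChain 𝟘 x k₁ → SatChain 𝟘 x k₂ → k₁ ≡ k₂

  ⋁ : Subset n → Fin n
  ⋁ T = List.foldr _∨_ 𝟘 (List.filter (_∈? T) (List.allFin n))

  Atomic : Set
  Atomic = ∀ x → Σ (Subset n) λ T → (∀ a → a ∈ T → IsAtom a) × x ≡ ⋁ T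

  _↓<_ : Subset n → Fin n → Subset n
  X ↓< x = tabulate (λ y → does (y ∈? X) ∧ does (y <? x))

  IsMaxBelow : Subset n → Fin n → Fin n → Set
  IsMaxBelow G p g = g ∈ G × g ≤ p × (∀ h → h ∈ G → h ≤ p → ¬ (g < h))

  isMaxBelow? : ∀ G p g → Dec (IsMaxBelow G p g)
  isMaxBelow? G p g = (g ∈? G) ×-dec (g ≤? p) ×-dec
    all? (λ h → (h ∈? G) →-dec ((h ≤? p) →-dec ¬? (g <? h)))

  F : Subset n → Fin n → Subset n
  F G p = tabulate (λ g → does (isMaxBelow? G p g))

  -- building set: G ⊆ L ∖ {0̂}, and for every p ≠ 0̂ a poset isomorphism
  -- φ : [0̂,p] → ∏_{g ∈ F_G(p)} [0̂,g] with φ(g) = (0̂,…,g,…,0̂).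
  -- An element of the product is represented by a function
  -- f : Fin n → Fin n with f g ≤ g for g ∈ F_G(p) (only those
  -- coordinates matter); φ x is such a function for x ∈ [0̂,p].
  record BuildingIso (G : Subset n) (p : Fin n) : Set where
    field
      φ          : Fin n → Fin n → Fin n
      φ-into     : ∀ x → x ≤ p → ∀ g → g ∈ F G p → φ x g ≤ g
      φ-mono     : ∀ x y → x ≤ p → y ≤ p → x ≤ y →
                   ∀ g → g ∈ F G p → φ x g ≤ φ y g
      φ-reflect  : ∀ x y → x ≤ p → y ≤ p →
                   (∀ g → g ∈ F G p → φ x g ≤ φ y g) → x ≤ y
      φ-onto     : ∀ (f : Fin n → Fin n) → (∀ g → g ∈ F G p → f g ≤ g) →
                   Σ (Fin n) λ x → x ≤ p × (∀ g → g ∈ F G p → φ x g ≡ f g)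
      φ-gen-self  : ∀ g → g ∈ F G p → φ g g ≡ g
      φ-gen-other : ∀ g h → g ∈ F G p → h ∈ F G p → h ≢ g → φ g h ≡ 𝟘

  IsBuildingSet : Subset n → Set
  IsBuildingSet G = 𝟘 ∉ G × (∀ p → p ≢ 𝟘 → BuildingIso G p)

  Nested : Subset n → Subset n → Set
  Nested G S = S ⊆ G ×
    (∀ (T : Subset n) → T ⊆ S → 2 ≤ℕ ∣ T ∣ →
       (∀ x y → x ∈ T → y ∈ T → x ≢ y → ¬ (x ≤ y)) → ⋁ T ∉ G)

  allSubsets : ∀ m → List (Subset m)
  allSubsets zero    = [] ∷ []
  allSubsets (suc m) = List.map (inside ∷_) (allSubsets m)
                    ++ List.map (outside ∷_) (allSubsets m)

  minimumℕ : List ℕ → ℕ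
  minimumℕ []       = 0
  minimumℕ (x ∷ xs) = List.foldr _⊓_ x xs

  -- Computed as the minimal size of a
  -- set T of atoms with B = ⋁ (H ∪ S_{<B} ∪ T).  (If no such T exists the
  -- value is 0; this never happens when ⋁(H ∪ S_{<B}) ≤ B and L is atomic.)
  d : Subset n → Subset n → Fin n → ℕ
  d S H B = minimumℕ (List.map ∣_∣ (List.filter ok? (allSubsets n)))
    where
      ok? : (T : Subset n) → Dec ((∀ a → a ∈ T → IsAtom a) × B ≡ ⋁ ((H ∪ (S ↓< B)) ∪ T))
      ok? T = all? (λ a → (a ∈? T) →-dec isAtom? a) ×-dec (B ≟ ⋁ ((H ∪ (S ↓< B)) ∪ T))

  sumOver : Subset n → (Fin n → ℕ) → ℕ
  sumOver X f = sum (List.map f (List.filter (_∈? X) (List.allFin n)))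

-- By construction d^S_{H,B} depends only on the join of H ∪ S_{<B}, so (1)–(4) are
-- identities between joins. Their one non-formal ingredient: if A ∈ H′ lies above some
-- F ∈ F_b, then b < A, for otherwise A and b overlap in F, so A ∨ b ∈ G₂, against the
-- nestedness of H′ ∪ M ∪ S. For (5) use [0̂,b] ≅ ∏_{F ∈ F_b} [0̂,F]: optimal atom sets
-- for the F ∈ F_b ∖ (S ∪ M) together complete b, and conversely an optimal atom set for
-- b splits, factor by factor, into atom sets completing these F; the parts are disjoint
-- because distinct factors meet only in 0̂.
module Submission where

open import Defs hiding (_<_; _↓<_)
import Defs

open import Data.Bool using (true; false)
open import Data.Empty using (⊥-elim)
open import Data.Fin using (Fin)
open import Data.Fin.Properties using (_≟_; all?; any?)
open import Data.Fin.Subset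
  using (Subset; _∈_; _∉_; _⊆_; ⁅_⁆; _∪_; _∩_; _─_; ⊥; ⋃; ∣_∣; Empty)
open import Data.Fin.Subset.Properties
  using ( _∈?_; x∈p∪q⁻; x∈p∩q⁺; x∈p∩q⁻; p⊆p∪q; q⊆p∪q; x∈⁅x⁆; x∈⁅y⁆⇒x≡y
        ; x≢y⇒x∉⁅y⁆; p─q⊆p; x∈p∧x∉q⇒x∈p─q; ∉⊥; ∣⊥∣≡0; ∣⁅x⁆∣≡1; Empty-unique
        ; p⊆q⇒∣p∣≤∣q∣; p⊂q⇒∣p∣<∣q∣ )
open import Data.List using (List; []; _∷_; map; filter; allFin)
open import Data.List.Membership.Propositional using (lose) renaming (_∈_ to _∈ₗ_)
open import Data.List.Membership.Propositional.Properties
  using (foldr-selective; ∈-++⁺ˡ; ∈-++⁺ʳ; ∈-filter⁺; ∈-filter⁻; ∈-allFin; ∈-map⁺; ∈-map⁻)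
open import Data.List.Properties
  using (foldr-preservesᵒ; foldr-preservesᵇ; filter-≐; map-cong; map-cong-local)
import Data.List.Relation.Unary.All as All
open import Data.List.Relation.Unary.AllPairs using (_∷_)
open import Data.List.Relation.Unary.Any using (Any; here; there)
open import Data.List.Relation.Unary.Unique.Propositional using (Unique)
import Data.List.Relation.Unary.Unique.Propositional.Properties as Unique
open import Data.Nat using (ℕ; suc; _+_; _⊓_) renaming (_≤_ to _≤ℕ_; _<_ to _<ℕ_)
import Data.Nat.Induction as ℕ
import Data.Nat.Properties as ℕ
open import Data.Nat.ListAction using (sum)
open import Data.Product using (∃-syntax; _×_; _,_; proj₁; proj₂)
open import Data.Sum as Sum using (_⊎_; inj₁; inj₂; [_,_]′)
open import Data.Vec using (tabulate; []; _∷_; here; there)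
open import Data.Vec.Properties using (lookup∘tabulate; lookup⇒[]=; []=⇒lookup)
open import Function using (id; _∘_; _on_)
open import Induction.WellFounded using (Acc; acc)
import Relation.Binary.Construct.NonStrictToStrict as NonStrictToStrict
import Relation.Binary.Construct.On as On
open import Relation.Binary.Lattice.Structures using (IsLattice)
open import Relation.Binary.PropositionalEquality
  using (_≡_; _≢_; refl; sym; trans; cong; subst; module ≡-Reasoning)
open import Relation.Nullary using (¬_; Dec; yes; no; does)
open import Relation.Nullary.Decidable using (dec-true; _×-dec_; _→-dec_)

private variable
  m : ℕ

-- Finite subsets

∈-tabulate⁺ : ∀ {P : Fin m → Set} (P? : ∀ x → Dec (P x)) {x} → P x → x ∈ tabulate (does ∘ P?)
∈-tabulate⁺ P? {x} px = lookup⇒[]= x _ (trans (lookup∘tabulate _ x) (dec-true (P? x) px))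

∈-tabulate⁻ : ∀ {P : Fin m → Set} (P? : ∀ x → Dec (P x)) {x} → x ∈ tabulate (does ∘ P?) → P x
∈-tabulate⁻ P? {x} x∈ with P? x | trans (sym (lookup∘tabulate (does ∘ P?) x)) ([]=⇒lookup x∈)
... | yes px | _ = px

x∈p─q⇒x∉q : ∀ (p q : Subset m) {x} → x ∈ p ─ q → x ∉ q
x∈p─q⇒x∉q (true ∷ p) (false ∷ q) here       ()
x∈p─q⇒x∉q (_ ∷ p)    (_ ∷ q)     (there x∈) (there x∈q) = x∈p─q⇒x∉q p q x∈ x∈q

∣p∪q∣+∣p∩q∣≡∣p∣+∣q∣ : ∀ (p q : Subset m) → ∣ p ∪ q ∣ + ∣ p ∩ q ∣ ≡ ∣ p ∣ + ∣ q ∣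
∣p∪q∣+∣p∩q∣≡∣p∣+∣q∣ []          []          = refl
∣p∪q∣+∣p∩q∣≡∣p∣+∣q∣ (true ∷ p)  (true ∷ q)  =
  cong suc (trans (ℕ.+-suc _ _) (trans (cong suc (∣p∪q∣+∣p∩q∣≡∣p∣+∣q∣ p q)) (sym (ℕ.+-suc _ _))))
∣p∪q∣+∣p∩q∣≡∣p∣+∣q∣ (true ∷ p)  (false ∷ q) = cong suc (∣p∪q∣+∣p∩q∣≡∣p∣+∣q∣ p q)
∣p∪q∣+∣p∩q∣≡∣p∣+∣q∣ (false ∷ p) (true ∷ q)  =
  trans (cong suc (∣p∪q∣+∣p∩q∣≡∣p∣+∣q∣ p q)) (sym (ℕ.+-suc _ _))
∣p∪q∣+∣p∩q∣≡∣p∣+∣q∣ (false ∷ p) (false ∷ q) = ∣p∪q∣+∣p∩q∣≡∣p∣+∣q∣ p q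

∣p∪q∣≤∣p∣+∣q∣ : ∀ (p q : Subset m) → ∣ p ∪ q ∣ ≤ℕ ∣ p ∣ + ∣ q ∣
∣p∪q∣≤∣p∣+∣q∣ p q = subst (∣ p ∪ q ∣ ≤ℕ_) (∣p∪q∣+∣p∩q∣≡∣p∣+∣q∣ p q) (ℕ.m≤m+n _ _)

Empty-∩⇒∣p∪q∣≡∣p∣+∣q∣ : ∀ (p q : Subset m) → Empty (p ∩ q) → ∣ p ∪ q ∣ ≡ ∣ p ∣ + ∣ q ∣
Empty-∩⇒∣p∪q∣≡∣p∣+∣q∣ {m} p q p∩q=∅ = begin
  ∣ p ∪ q ∣               ≡⟨ sym (ℕ.+-identityʳ _) ⟩
  ∣ p ∪ q ∣ + 0           ≡⟨ cong (∣ p ∪ q ∣ +_) (sym (∣⊥∣≡0 m)) ⟩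
  ∣ p ∪ q ∣ + ∣ ⊥ {m} ∣   ≡⟨ cong (λ r → ∣ p ∪ q ∣ + ∣ r ∣) (sym (Empty-unique p∩q=∅)) ⟩
  ∣ p ∪ q ∣ + ∣ p ∩ q ∣   ≡⟨ ∣p∪q∣+∣p∩q∣≡∣p∣+∣q∣ p q ⟩
  ∣ p ∣ + ∣ q ∣           ∎
  where open ≡-Reasoning

module _ {A : Set} (f : A → Subset m) where

  ∈⋃-map⁺ : ∀ {xs y i} → y ∈ₗ xs → i ∈ f y → i ∈ ⋃ (map f xs)
  ∈⋃-map⁺ (here refl) i∈ = p⊆p∪q _ i∈
  ∈⋃-map⁺ (there y∈)  i∈ = q⊆p∪q _ _ (∈⋃-map⁺ y∈ i∈)

  ∈⋃-map⁻ : ∀ xs {i} → i ∈ ⋃ (map f xs) → ∃[ y ] y ∈ₗ xs × i ∈ f y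
  ∈⋃-map⁻ []       i∈ = ⊥-elim (∉⊥ i∈)
  ∈⋃-map⁻ (x ∷ xs) i∈ with x∈p∪q⁻ (f x) _ i∈
  ... | inj₁ i∈fx = x , here refl , i∈fx
  ... | inj₂ i∈⋃  = let y , y∈ , i∈fy = ∈⋃-map⁻ xs i∈⋃ in y , there y∈ , i∈fy

  ∣⋃-map∣≤sum : ∀ xs → ∣ ⋃ (map f xs) ∣ ≤ℕ sum (map (∣_∣ ∘ f) xs)
  ∣⋃-map∣≤sum []       = ℕ.≤-reflexive (∣⊥∣≡0 m)
  ∣⋃-map∣≤sum (x ∷ xs) =
    ℕ.≤-trans (∣p∪q∣≤∣p∣+∣q∣ (f x) _) (ℕ.+-monoʳ-≤ ∣ f x ∣ (∣⋃-map∣≤sum xs))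

  ∣⋃-map∣≡sum : ∀ {xs} → Unique xs →
                (∀ {x y} → x ∈ₗ xs → y ∈ₗ xs → x ≢ y → Empty (f x ∩ f y)) →
                ∣ ⋃ (map f xs) ∣ ≡ sum (map (∣_∣ ∘ f) xs)
  ∣⋃-map∣≡sum {[]}     _              _        = ∣⊥∣≡0 m
  ∣⋃-map∣≡sum {x ∷ xs} (x∉xs ∷ uniq) disjoint = trans
    (Empty-∩⇒∣p∪q∣≡∣p∣+∣q∣ (f x) _ fx∩⋃=∅)
    (cong (∣ f x ∣ +_) (∣⋃-map∣≡sum uniq (λ x∈ y∈ → disjoint (there x∈) (there y∈))))
    where
    fx∩⋃=∅ : Empty (f x ∩ ⋃ (map f xs))
    fx∩⋃=∅ (i , i∈) with x∈p∩q⁻ (f x) _ i∈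
    ... | i∈fx , i∈⋃ with ∈⋃-map⁻ xs i∈⋃
    ...   | y , y∈ , i∈fy =
      disjoint (here refl) (there y∈) (All.lookup x∉xs y∈) (i , x∈p∩q⁺ (i∈fx , i∈fy))

sum-map-mono : ∀ {A : Set} {f g : A → ℕ} xs → (∀ {x} → x ∈ₗ xs → f x ≤ℕ g x) →
               sum (map f xs) ≤ℕ sum (map g xs)
sum-map-mono []       _   = ℕ.≤-refl
sum-map-mono (x ∷ xs) f≤g = ℕ.+-mono-≤ (f≤g (here refl)) (sum-map-mono xs (f≤g ∘ there))

elements : Subset m → List (Fin m)
elements {m} X = filter (_∈? X) (allFin m)

∈-elements⁺ : ∀ {X : Subset m} {x} → x ∈ X → x ∈ₗ elements X
∈-elements⁺ {x = x} x∈X = ∈-filter⁺ (_∈? _) (∈-allFin x) x∈X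

∈-elements⁻ : ∀ {X : Subset m} {x} → x ∈ₗ elements X → x ∈ X
∈-elements⁻ {m} {X} x∈ = proj₂ (∈-filter⁻ (_∈? X) {xs = allFin m} x∈)

elements-unique : ∀ (X : Subset m) → Unique (elements X)
elements-unique {m} X = Unique.filter⁺ (_∈? X) (Unique.allFin⁺ m)

-- Joins and the minimal number d of atoms

module FinLatticeProperties (L : FinLattice) where
  open FinLattice L
  open IsLattice isLattice public
    using (isPartialOrder; x≤x∨y; y≤x∨y; ∨-least)
    renaming (refl to ≤-refl; reflexive to ≤-reflexive; trans to ≤-trans; antisym to ≤-antisym)
  private module Strict = NonStrictToStrict _≡_ _≤_

  infix 4 _<_

  _<_ : Fin n → Fin n → Set
  _<_ = Defs._<_ L

  _↓<_ : Subset n → Fin n → Subset n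
  _↓<_ = Defs._↓<_ L

  _↓≤_ : Subset n → Fin n → Subset n
  X ↓≤ A = tabulate (does ∘ λ x → (x ∈? X) ×-dec (x ≤? A))

  <-irrefl : ∀ {x} → ¬ x < x
  <-irrefl = Strict.<-irrefl refl

  <-trans : ∀ {x y z} → x < y → y < z → x < z
  <-trans = Strict.<-trans isPartialOrder

  ≤𝟘⇒≡𝟘 : ∀ {x} → x ≤ 𝟘 → x ≡ 𝟘
  ≤𝟘⇒≡𝟘 x≤𝟘 = ≤-antisym x≤𝟘 (𝟘-minimum _)

  ≢𝟘-upward : ∀ {x y} → x ≢ 𝟘 → x ≤ y → y ≢ 𝟘
  ≢𝟘-upward x≢𝟘 x≤y refl = x≢𝟘 (≤𝟘⇒≡𝟘 x≤y)

  ∈↓<⁺ : ∀ {X A x} → x ∈ X → x < A → x ∈ X ↓< A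
  ∈↓<⁺ {X} {A} x∈X x<A = ∈-tabulate⁺ (λ y → (y ∈? X) ×-dec (_<?_ L y A)) (x∈X , x<A)

  ∈↓<⁻ : ∀ {X A x} → x ∈ X ↓< A → x ∈ X × x < A
  ∈↓<⁻ {X} {A} = ∈-tabulate⁻ (λ y → (y ∈? X) ×-dec (_<?_ L y A))

  ↓<-mono : ∀ {X Y A} → X ⊆ Y → X ↓< A ⊆ Y ↓< A
  ↓<-mono X⊆Y x∈ = let x∈X , x<A = ∈↓<⁻ x∈ in ∈↓<⁺ (X⊆Y x∈X) x<A

  ∈↓≤⁺ : ∀ {X A x} → x ∈ X → x ≤ A → x ∈ X ↓≤ A
  ∈↓≤⁺ {X} {A} x∈X x≤A = ∈-tabulate⁺ (λ y → (y ∈? X) ×-dec (y ≤? A)) (x∈X , x≤A)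

  ∈↓≤⁻ : ∀ {X A x} → x ∈ X ↓≤ A → x ∈ X × x ≤ A
  ∈↓≤⁻ {X} {A} = ∈-tabulate⁻ (λ y → (y ∈? X) ×-dec (y ≤? A))

  ∈F⁺ : ∀ {G p g} → IsMaxBelow L G p g → g ∈ F L G p
  ∈F⁺ {G} {p} = ∈-tabulate⁺ (isMaxBelow? L G p)

  ∈F⁻ : ∀ {G p g} → g ∈ F L G p → IsMaxBelow L G p g
  ∈F⁻ {G} {p} = ∈-tabulate⁻ (isMaxBelow? L G p)

  ⋁-upper : ∀ X {x} → x ∈ X → x ≤ ⋁ L X
  ⋁-upper X {x} x∈X =
    foldr-preservesᵒ {P = x ≤_} below-∨ 𝟘 (elements X) (inj₂ (lose (∈-elements⁺ x∈X) ≤-refl))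
    where
    below-∨ : ∀ a c → x ≤ a ⊎ x ≤ c → x ≤ (a ∨ c)
    below-∨ a c = [ (λ x≤a → ≤-trans x≤a (x≤x∨y a c)) , (λ x≤c → ≤-trans x≤c (y≤x∨y a c)) ]′

  ⋁-least : ∀ X {u} → (∀ {x} → x ∈ X → x ≤ u) → ⋁ L X ≤ u
  ⋁-least X {u} bound =
    foldr-preservesᵇ {P = _≤ u} ∨-least (𝟘-minimum u) (All.tabulate (bound ∘ ∈-elements⁻))

  ⋁-mono : ∀ {X Y} → X ⊆ Y → ⋁ L X ≤ ⋁ L Y
  ⋁-mono {X} {Y} X⊆Y = ⋁-least X (⋁-upper Y ∘ X⊆Y)

  ⋁-∪ : ∀ X Y → ⋁ L (X ∪ Y) ≡ ⋁ L X ∨ ⋁ L Y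
  ⋁-∪ X Y = ≤-antisym
    (⋁-least (X ∪ Y) λ x∈ → [ (λ x∈X → ≤-trans (⋁-upper X x∈X) (x≤x∨y _ _))
                             , (λ x∈Y → ≤-trans (⋁-upper Y x∈Y) (y≤x∨y _ _)) ]′ (x∈p∪q⁻ X Y x∈))
    (∨-least (⋁-mono (p⊆p∪q Y)) (⋁-mono (q⊆p∪q X Y)))

  ↓<-bounded : ∀ {X S B x} → x ∈ (X ↓< B) ∪ (S ↓< B) → x ≤ B
  ↓<-bounded x∈ = [ proj₁ ∘ proj₂ ∘ ∈↓<⁻ , proj₁ ∘ proj₂ ∘ ∈↓<⁻ ]′ (x∈p∪q⁻ _ _ x∈)

  ∈↓<-≤⋁ : ∀ {H S A x} → x ∈ S → x < A → x ≤ ⋁ L (H ∪ (S ↓< A))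
  ∈↓<-≤⋁ x∈S x<A = ⋁-upper _ (q⊆p∪q _ _ (∈↓<⁺ x∈S x<A))

  minimumℕ-≤ : ∀ {xs y} → y ∈ₗ xs → minimumℕ L xs ≤ℕ y
  minimumℕ-≤ {x ∷ xs} {y} y∈ = foldr-preservesᵒ {P = _≤ℕ y} ⊓-below x xs (first-or-rest y∈)
    where
    ⊓-below : ∀ a c → a ≤ℕ y ⊎ c ≤ℕ y → a ⊓ c ≤ℕ y
    ⊓-below a c = [ ℕ.≤-trans (ℕ.m⊓n≤m a c) , ℕ.≤-trans (ℕ.m⊓n≤n a c) ]′
    first-or-rest : y ∈ₗ x ∷ xs → x ≤ℕ y ⊎ Any (_≤ℕ y) xs
    first-or-rest (here refl) = inj₁ ℕ.≤-refl
    first-or-rest (there y∈)  = inj₂ (lose y∈ ℕ.≤-refl)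

  minimumℕ-∈ : ∀ {xs y} → y ∈ₗ xs → minimumℕ L xs ∈ₗ xs
  minimumℕ-∈ {x ∷ xs} _ = [ here , there ]′ (foldr-selective ℕ.⊓-sel x xs)

  ∈-allSubsets : ∀ {m} (T : Subset m) → T ∈ₗ allSubsets L m
  ∈-allSubsets []          = here refl
  ∈-allSubsets (true ∷ T)  = ∈-++⁺ˡ (∈-map⁺ (true ∷_) (∈-allSubsets T))
  ∈-allSubsets (false ∷ T) = ∈-++⁺ʳ _ (∈-map⁺ (false ∷_) (∈-allSubsets T))

  Completes : Subset n → Subset n → Fin n → Subset n → Set
  Completes S H B T = (∀ a → a ∈ T → IsAtom L a) × B ≡ ⋁ L ((H ∪ (S ↓< B)) ∪ T)

  -- Literally the test inside d, so d S H B unfolds to a minimum over completing sets.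
  completes? : ∀ S H B T → Dec (Completes S H B T)
  completes? S H B T =
    all? (λ a → (a ∈? T) →-dec isAtom? L a) ×-dec (B ≟ ⋁ L ((H ∪ (S ↓< B)) ∪ T))

  d≤∣T∣ : ∀ {S H B T} → Completes S H B T → d L S H B ≤ℕ ∣ T ∣
  d≤∣T∣ {S} {H} {B} {T} completes =
    minimumℕ-≤ (∈-map⁺ ∣_∣ (∈-filter⁺ (completes? S H B) (∈-allSubsets T) completes))

  atomsBelow : Fin n → Subset n
  atomsBelow B = tabulate (does ∘ λ a → isAtom? L a ×-dec (a ≤? B))

  atomsBelow-completes : Atomic L → ∀ {S H B} → (∀ {x} → x ∈ H ∪ (S ↓< B) → x ≤ B) →
                         Completes S H B (atomsBelow B)
  atomsBelow-completes atomic {S} {H} {B} bounded =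
    (λ _ → proj₁ ∘ ∈-tabulate⁻ atom-below?) ,
    ≤-antisym B≤⋁ (⋁-least _ λ x∈ → [ bounded , proj₂ ∘ ∈-tabulate⁻ atom-below? ]′ (x∈p∪q⁻ _ _ x∈))
    where
    atom-below? : ∀ a → Dec (IsAtom L a × a ≤ B)
    atom-below? a = isAtom? L a ×-dec (a ≤? B)
    B≤⋁ : B ≤ ⋁ L ((H ∪ (S ↓< B)) ∪ atomsBelow B)
    B≤⋁ with atomic B
    ... | T , atoms , B≡⋁T = subst (_≤ ⋁ L ((H ∪ (S ↓< B)) ∪ atomsBelow B)) (sym B≡⋁T)
      (⋁-least T λ {a} a∈T → ⋁-upper _ (q⊆p∪q _ _ (∈-tabulate⁺ atom-below?
        (atoms a a∈T , subst (a ≤_) (sym B≡⋁T) (⋁-upper T a∈T)))))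

  record OptimalCompletion (S H : Subset n) (B : Fin n) : Set where
    field
      set   : Subset n
      atoms : ∀ a → a ∈ set → IsAtom L a
      joins : B ≡ ⋁ L ((H ∪ (S ↓< B)) ∪ set)
      size  : ∣ set ∣ ≡ d L S H B

  d-attained : Atomic L → ∀ {S H B} → (∀ {x} → x ∈ H ∪ (S ↓< B) → x ≤ B) →
               OptimalCompletion S H B
  d-attained atomic {S} {H} {B} bounded
    with ∈-map⁻ ∣_∣ (minimumℕ-∈ (∈-map⁺ ∣_∣ (∈-filter⁺ (completes? S H B)
           (∈-allSubsets (atomsBelow B)) (atomsBelow-completes atomic bounded))))
  ... | T , T∈ , d≡∣T∣ with proj₂ (∈-filter⁻ (completes? S H B) {xs = allSubsets L n} T∈)
  ...   | atoms , joins = record { set = T ; atoms = atoms ; joins = joins ; size = sym d≡∣T∣ }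

  d-cong : ∀ {S₁ H₁ S₂ H₂ B} → ⋁ L (H₁ ∪ (S₁ ↓< B)) ≡ ⋁ L (H₂ ∪ (S₂ ↓< B)) →
           d L S₁ H₁ B ≡ d L S₂ H₂ B
  d-cong {S₁} {H₁} {S₂} {H₂} {B} same-join = cong (minimumℕ L ∘ map ∣_∣)
    (filter-≐ (completes? S₁ H₁ B) (completes? S₂ H₂ B)
      ((λ (atoms , eq) → atoms , trans eq (⋁-∪-cong _)) ,
       (λ (atoms , eq) → atoms , trans eq (sym (⋁-∪-cong _))))
      (allSubsets L n))
    where
    ⋁-∪-cong : ∀ T → ⋁ L ((H₁ ∪ (S₁ ↓< B)) ∪ T) ≡ ⋁ L ((H₂ ∪ (S₂ ↓< B)) ∪ T)
    ⋁-∪-cong T = trans (⋁-∪ _ T) (trans (cong (_∨ ⋁ L T) same-join) (sym (⋁-∪ _ T)))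

  d-∪-redundant : ∀ {S X K A} →
                  (∀ {x} → x ∈ K → x < A → x ≤ ⋁ L ((X ↓< A) ∪ (S ↓< A))) →
                  d L S ((X ∪ K) ↓< A) A ≡ d L S (X ↓< A) A
  d-∪-redundant {S} {X} {K} {A} K-redundant = d-cong (≤-antisym (⋁-least _ bounded) (⋁-mono smaller))
    where
    bounded : ∀ {x} → x ∈ ((X ∪ K) ↓< A) ∪ (S ↓< A) → x ≤ ⋁ L ((X ↓< A) ∪ (S ↓< A))
    bounded x∈ with x∈p∪q⁻ _ _ x∈
    ... | inj₂ x∈S↓A  = ⋁-upper _ (q⊆p∪q _ _ x∈S↓A)
    ... | inj₁ x∈XK↓A with ∈↓<⁻ x∈XK↓A
    ...   | x∈XK , x<A = [ (λ x∈X → ⋁-upper _ (p⊆p∪q _ (∈↓<⁺ x∈X x<A)))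
                         , (λ x∈K → K-redundant x∈K x<A) ]′ (x∈p∪q⁻ X K x∈XK)
    smaller : (X ↓< A) ∪ (S ↓< A) ⊆ ((X ∪ K) ↓< A) ∪ (S ↓< A)
    smaller x∈ = [ p⊆p∪q _ ∘ ↓<-mono (p⊆p∪q K) , q⊆p∪q _ _ ]′ (x∈p∪q⁻ _ _ x∈)

  d-∪-⊆ : ∀ {S X K A} → K ⊆ S → d L S ((X ∪ K) ↓< A) A ≡ d L S (X ↓< A) A
  d-∪-⊆ K⊆S = d-∪-redundant λ x∈K x<A → ∈↓<-≤⋁ (K⊆S x∈K) x<A

  -- Building sets and nested sets

  maximal-above : ∀ G {p x} → x ∈ G → x ≤ p → ∃[ g ] g ∈ F L G p × x ≤ g
  maximal-above G {p} {x} = climb (On.wellFounded (∣_∣ ∘ above) ℕ.<-wellFounded x)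
    where
    above? : ∀ y z → Dec (z ∈ G × z ≤ p × y < z)
    above? y z = (z ∈? G) ×-dec (z ≤? p) ×-dec (_<?_ L y z)
    above : Fin n → Subset n
    above y = tabulate (does ∘ above? y)
    shrinks : ∀ {y h} → h ∈ G → h ≤ p → y < h → ∣ above h ∣ <ℕ ∣ above y ∣
    shrinks h∈G h≤p y<h = p⊂q⇒∣p∣<∣q∣
      ( (λ z∈ → let z∈G , z≤p , h<z = ∈-tabulate⁻ (above? _) z∈
                in ∈-tabulate⁺ (above? _) (z∈G , z≤p , <-trans y<h h<z))
      , _ , ∈-tabulate⁺ (above? _) (h∈G , h≤p , y<h)
      , λ h∈ → <-irrefl (proj₂ (proj₂ (∈-tabulate⁻ (above? _) h∈))) )
    climb : ∀ {y} → Acc (_<ℕ_ on (∣_∣ ∘ above)) y → y ∈ G → y ≤ p → ∃[ g ] g ∈ F L G p × y ≤ g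
    climb {y} (acc rec) y∈G y≤p with any? (above? y)
    ... | no nothing-above =
      y , ∈F⁺ (y∈G , y≤p , λ h h∈G h≤p y<h → nothing-above (h , h∈G , h≤p , y<h)) , ≤-refl
    ... | yes (h , h∈G , h≤p , y<h) =
      let g , g∈F , h≤g = climb (rec (shrinks h∈G h≤p y<h)) h∈G h≤p in g , g∈F , ≤-trans (proj₁ y<h) h≤g

  module BuildingIsoProperties {G p} (I : BuildingIso L G p) where
    open BuildingIso I

    factor≤p : ∀ {g} → g ∈ F L G p → g ≤ p
    factor≤p = proj₁ ∘ proj₂ ∘ ∈F⁻

    φ-off-factor : ∀ {g h x} → g ∈ F L G p → h ∈ F L G p → h ≢ g → x ≤ g → φ x h ≡ 𝟘
    φ-off-factor {g} {h} {x} g∈F h∈F h≢g x≤g = ≤𝟘⇒≡𝟘 (≤-trans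
      (φ-mono x g (≤-trans x≤g (factor≤p g∈F)) (factor≤p g∈F) x≤g h h∈F)
      (≤-reflexive (φ-gen-other g h g∈F h∈F h≢g)))

    φ≡𝟘⇒≡𝟘 : ∀ {x} → x ≤ p → (∀ {g} → g ∈ F L G p → φ x g ≡ 𝟘) → x ≡ 𝟘
    φ≡𝟘⇒≡𝟘 {x} x≤p φx≡𝟘 = ≤𝟘⇒≡𝟘 (φ-reflect x 𝟘 x≤p (𝟘-minimum p)
      λ g g∈F → subst (_≤ φ 𝟘 g) (sym (φx≡𝟘 g∈F)) (𝟘-minimum _))

    factors-meet-in-𝟘 : ∀ {g₁ g₂ x} → g₁ ∈ F L G p → g₂ ∈ F L G p → g₁ ≢ g₂ →
                        x ≤ g₁ → x ≤ g₂ → x ≡ 𝟘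
    factors-meet-in-𝟘 {g₁} {g₂} g₁∈F g₂∈F g₁≢g₂ x≤g₁ x≤g₂ =
      φ≡𝟘⇒≡𝟘 (≤-trans x≤g₁ (factor≤p g₁∈F)) coordinate
      where
      coordinate : ∀ {h} → h ∈ F L G p → φ _ h ≡ 𝟘
      coordinate {h} h∈F with h ≟ g₁
      ... | yes refl = φ-off-factor g₂∈F h∈F g₁≢g₂ x≤g₂
      ... | no h≢g₁  = φ-off-factor g₁∈F h∈F h≢g₁ x≤g₁

    ≤⋁factors : p ≤ ⋁ L (F L G p)
    ≤⋁factors = φ-reflect p (⋁ L (F L G p)) ≤-refl ⋁F≤p λ g g∈F →
      ≤-trans (φ-into p ≤-refl g g∈F)
        (subst (_≤ φ (⋁ L (F L G p)) g) (φ-gen-self g g∈F)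
          (φ-mono g _ (factor≤p g∈F) ⋁F≤p (⋁-upper _ g∈F) g g∈F))
      where
      ⋁F≤p : ⋁ L (F L G p) ≤ p
      ⋁F≤p = ⋁-least _ factor≤p

    replace-coordinate : ∀ {g y} → g ∈ F L G p → y ≤ g →
                         ∃[ z ] z ≤ p × φ z g ≡ φ y g × (∀ {h} → h ∈ F L G p → h ≢ g → φ z h ≡ φ p h)
    replace-coordinate {g} {y} g∈F y≤g with φ-onto f f-into
      where
      f : Fin n → Fin n
      f h with h ≟ g
      ... | yes _ = φ y g
      ... | no _  = φ p h
      f-into : ∀ h → h ∈ F L G p → f h ≤ h
      f-into h h∈F with h ≟ g
      ... | yes refl = φ-into y (≤-trans y≤g (factor≤p g∈F)) h h∈F
      ... | no _     = φ-into p ≤-refl h h∈F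
    ... | z , z≤p , φz≡f = z , z≤p , at-g , off-g
      where
      at-g : φ z g ≡ φ y g
      at-g with φz≡f g g∈F
      ... | φzg≡fg with g ≟ g
      ...   | yes _   = φzg≡fg
      ...   | no g≢g = ⊥-elim (g≢g refl)
      off-g : ∀ {h} → h ∈ F L G p → h ≢ g → φ z h ≡ φ p h
      off-g {h} h∈F h≢g with φz≡f h h∈F
      ... | φzh≡fh with h ≟ g
      ...   | yes h≡g = ⊥-elim (h≢g h≡g)
      ...   | no _    = φzh≡fh

    -- Each x ∈ X ⊆ G lies under a single factor, so the g-coordinate of p ≤ ⋁ X
    -- is already the join of the elements of X below g.
    factor≤ : ∀ X {g y} → (∀ {x} → x ∈ X → x ∈ G × x ≤ p) → p ≤ ⋁ L X →
              g ∈ F L G p → y ≤ g → (∀ {x} → x ∈ X → x ≤ g → x ≤ y) → g ≤ y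
    factor≤ X {g} {y} X⊆G↓p p≤⋁X g∈F y≤g below-g⇒≤y with replace-coordinate g∈F y≤g
    ... | z , z≤p , φzg≡φyg , φzh≡φph =
      φ-reflect g y g≤p (≤-trans y≤g g≤p) λ h h∈F → g-coordinate h∈F
      where
      g≤p = factor≤p g∈F
      X≤z : ∀ {x} → x ∈ X → x ≤ z
      X≤z {x} x∈X = φ-reflect x z x≤p z≤p λ h h∈F → coordinate h∈F
        where
        x≤p = proj₂ (X⊆G↓p x∈X)
        coordinate : ∀ {h} → h ∈ F L G p → φ x h ≤ φ z h
        coordinate {h} h∈F with h ≟ g
        ... | no h≢g = ≤-trans (φ-mono x p x≤p ≤-refl x≤p h h∈F) (≤-reflexive (sym (φzh≡φph h∈F h≢g)))
        ... | yes refl with maximal-above G (proj₁ (X⊆G↓p x∈X)) x≤p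
        ...   | g′ , g′∈F , x≤g′ with g′ ≟ h
        ...     | yes refl = ≤-trans (φ-mono x y x≤p (≤-trans y≤g g≤p) (below-g⇒≤y x∈X x≤g′) h h∈F)
                                     (≤-reflexive (sym φzg≡φyg))
        ...     | no g′≢h  = subst (_≤ φ z h) (sym (φ-off-factor g′∈F h∈F (g′≢h ∘ sym) x≤g′))
                                   (𝟘-minimum _)
      p≤z : p ≤ z
      p≤z = ≤-trans p≤⋁X (⋁-least X X≤z)
      g-coordinate : ∀ {h} → h ∈ F L G p → φ g h ≤ φ y h
      g-coordinate {h} h∈F with h ≟ g
      ... | yes refl = ≤-trans (φ-mono g p g≤p ≤-refl g≤p g g∈F)
                         (≤-trans (φ-mono p z ≤-refl z≤p p≤z g g∈F) (≤-reflexive φzg≡φyg))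
      ... | no h≢g   = subst (_≤ φ y h) (sym (φ-gen-other g h g∈F h∈F h≢g)) (𝟘-minimum _)

  module BuildingSetProperties {G} (building : IsBuildingSet L G) where
    open module Iso {p} (p≢𝟘 : p ≢ 𝟘) = BuildingIsoProperties (proj₂ building p p≢𝟘) public

    ∈G⇒≢𝟘 : ∀ {x} → x ∈ G → x ≢ 𝟘
    ∈G⇒≢𝟘 x∈G refl = proj₁ building x∈G

    atom∈G : ∀ {a} → IsAtom L a → a ∈ G
    atom∈G {a} ((_ , 𝟘≢a) , covers) with any? (λ g → g ∈? F L G a)
    ... | no no-factor =
      ⊥-elim (𝟘≢a (sym (φ≡𝟘⇒≡𝟘 (𝟘≢a ∘ sym) ≤-refl λ g∈F → ⊥-elim (no-factor (_ , g∈F)))))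
    ... | yes (g , g∈F) with ∈F⁻ g∈F | g ≟ a
    ...   | g∈G , _   , _ | yes refl = g∈G
    ...   | g∈G , g≤a , _ | no g≢a   =
      ⊥-elim (covers g (𝟘-minimum g , ∈G⇒≢𝟘 g∈G ∘ sym) (g≤a , g≢a))

    ∨∈G-of-overlapping : ∀ {A B x} → A ∈ G → B ∈ G → x ≢ 𝟘 → x ≤ A → x ≤ B → (A ∨ B) ∈ G
    ∨∈G-of-overlapping {A} {B} {x} A∈G B∈G x≢𝟘 x≤A x≤B =
      same-factor (maximal-above G A∈G (x≤x∨y A B)) (maximal-above G B∈G (y≤x∨y A B))
      where
      A∨B≢𝟘 : A ∨ B ≢ 𝟘
      A∨B≢𝟘 = ≢𝟘-upward x≢𝟘 (≤-trans x≤A (x≤x∨y A B))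
      same-factor : ∃[ g ] g ∈ F L G (A ∨ B) × A ≤ g → ∃[ g ] g ∈ F L G (A ∨ B) × B ≤ g →
                    (A ∨ B) ∈ G
      same-factor (g₁ , g₁∈F , A≤g₁) (g₂ , g₂∈F , B≤g₂) with g₁ ≟ g₂
      ... | yes refl = subst (_∈ G) (≤-antisym (factor≤p A∨B≢𝟘 g₁∈F) (∨-least A≤g₁ B≤g₂))
                             (proj₁ (∈F⁻ g₁∈F))
      ... | no g₁≢g₂ = ⊥-elim (x≢𝟘 (factors-meet-in-𝟘 A∨B≢𝟘 g₁∈F g₂∈F g₁≢g₂
                                      (≤-trans x≤A A≤g₁) (≤-trans x≤B B≤g₂)))

  nested-incomparable-∨∉ : ∀ {G S A B} → Nested L G S → A ∈ S → B ∈ S →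
                           ¬ A ≤ B → ¬ B ≤ A → (A ∨ B) ∉ G
  nested-incomparable-∨∉ {G} {S} {A} {B} (_ , no-nested-join) A∈S B∈S A≰B B≰A A∨B∈G =
    no-nested-join pair pair⊆S two-elements incomparable (subst (_∈ G) (sym ⋁pair≡A∨B) A∨B∈G)
    where
    pair = ⁅ A ⁆ ∪ ⁅ B ⁆
    A-or-B : ∀ {x} → x ∈ pair → x ≡ A ⊎ x ≡ B
    A-or-B x∈ = Sum.map (x∈⁅y⁆⇒x≡y A) (x∈⁅y⁆⇒x≡y B) (x∈p∪q⁻ _ _ x∈)
    pair⊆S : pair ⊆ S
    pair⊆S x∈ with A-or-B x∈
    ... | inj₁ refl = A∈S
    ... | inj₂ refl = B∈S
    two-elements : 2 ≤ℕ ∣ pair ∣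
    two-elements = subst (λ k → suc k ≤ℕ ∣ pair ∣) (∣⁅x⁆∣≡1 A) (p⊂q⇒∣p∣<∣q∣
      (p⊆p∪q _ , B , q⊆p∪q _ _ (x∈⁅x⁆ B) , λ B∈⁅A⁆ → B≰A (≤-reflexive (x∈⁅y⁆⇒x≡y A B∈⁅A⁆))))
    incomparable : ∀ x y → x ∈ pair → y ∈ pair → x ≢ y → ¬ x ≤ y
    incomparable x y x∈ y∈ x≢y with A-or-B x∈ | A-or-B y∈
    ... | inj₁ refl | inj₁ refl = ⊥-elim (x≢y refl)
    ... | inj₁ refl | inj₂ refl = A≰B
    ... | inj₂ refl | inj₁ refl = B≰A
    ... | inj₂ refl | inj₂ refl = ⊥-elim (x≢y refl)
    ⋁pair≡A∨B : ⋁ L pair ≡ A ∨ B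
    ⋁pair≡A∨B = ≤-antisym
      (⋁-least pair λ x∈ → [ (λ { refl → x≤x∨y A B }) , (λ { refl → y≤x∨y A B }) ]′ (A-or-B x∈))
      (∨-least (⋁-upper pair (p⊆p∪q _ (x∈⁅x⁆ A))) (⋁-upper pair (q⊆p∪q _ _ (x∈⁅x⁆ B))))

-- Adding b to the building set G₁

module BuildingSetExtension
  (L : FinLattice) (atomic : Atomic L)
  (G₁ : Subset (FinLattice.n L)) (b : Fin (FinLattice.n L)) (b∉G₁ : b ∉ G₁)
  (building₁ : IsBuildingSet L G₁) (building₂ : IsBuildingSet L (G₁ ∪ ⁅ b ⁆))
  (S : Subset (FinLattice.n L)) (S-nested : Nested L (G₁ ∪ ⁅ b ⁆) S) (b∈S : b ∈ S)
  (H′ M : Subset (FinLattice.n L)) (H′⊆G₁ : H′ ⊆ G₁) (M⊆Fb : M ⊆ F L G₁ b)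
  (H′∩Fb=∅ : Empty (H′ ∩ F L G₁ b)) (H′MS-nested : Nested L (G₁ ∪ ⁅ b ⁆) ((H′ ∪ M) ∪ S))
  where

  open FinLattice L
  open FinLatticeProperties L
  private
    module G₁ = BuildingSetProperties building₁
    module G₂ = BuildingSetProperties building₂

  Fb : Subset n
  Fb = F L G₁ b

  S′ : Subset n
  S′ = (S ─ ⁅ b ⁆) ∪ Fb

  b≢𝟘 : b ≢ 𝟘
  b≢𝟘 = G₂.∈G⇒≢𝟘 (q⊆p∪q _ _ (x∈⁅x⁆ b))

  ∈G₁⇒≢b : ∀ {x} → x ∈ G₁ → x ≢ b
  ∈G₁⇒≢b x∈G₁ refl = b∉G₁ x∈G₁

  Fb⊆G₁ : Fb ⊆ G₁
  Fb⊆G₁ = proj₁ ∘ ∈F⁻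

  Fb<b : ∀ {g} → g ∈ Fb → g < b
  Fb<b g∈Fb = proj₁ (proj₂ (∈F⁻ g∈Fb)) , ∈G₁⇒≢b (Fb⊆G₁ g∈Fb)

  Fb-maximal : ∀ {g A} → g ∈ Fb → A ∈ G₁ → A ≤ b → ¬ g < A
  Fb-maximal g∈Fb = proj₂ (proj₂ (∈F⁻ g∈Fb)) _

  Fb-antichain : ∀ {g h} → g ∈ Fb → h ∈ Fb → ¬ g < h
  Fb-antichain g∈Fb h∈Fb = Fb-maximal g∈Fb (Fb⊆G₁ h∈Fb) (proj₁ (Fb<b h∈Fb))

  factor-below⇒b< : ∀ {A g} → A ∈ H′ ∪ Fb → g ∈ Fb → g < A → b < A
  factor-below⇒b< {A} {g} A∈ g∈Fb g<A with x∈p∪q⁻ H′ Fb A∈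
  ... | inj₂ A∈Fb = ⊥-elim (Fb-antichain g∈Fb A∈Fb g<A)
  ... | inj₁ A∈H′ with b ≤? A | A ≤? b
  ...   | yes b≤A | _       = b≤A , ∈G₁⇒≢b (H′⊆G₁ A∈H′) ∘ sym
  ...   | no _    | yes A≤b = ⊥-elim (Fb-maximal g∈Fb (H′⊆G₁ A∈H′) A≤b g<A)
  ...   | no b≰A  | no A≰b  = ⊥-elim (nested-incomparable-∨∉ H′MS-nested
          (p⊆p∪q S (p⊆p∪q M A∈H′)) (q⊆p∪q _ _ b∈S) A≰b b≰A
          (G₂.∨∈G-of-overlapping (p⊆p∪q _ (H′⊆G₁ A∈H′)) (q⊆p∪q _ _ (x∈⁅x⁆ b))
            (G₁.∈G⇒≢𝟘 (Fb⊆G₁ g∈Fb)) (proj₁ g<A) (proj₁ (Fb<b g∈Fb))))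

  d-H′∪M≡d-H′ : ∀ {A} → A ∈ H′ ∪ Fb → d L S ((H′ ∪ M) ↓< A) A ≡ d L S (H′ ↓< A) A
  d-H′∪M≡d-H′ A∈ = d-∪-redundant λ x∈M x<A →
    ≤-trans (proj₁ (Fb<b (M⊆Fb x∈M))) (∈↓<-≤⋁ b∈S (factor-below⇒b< A∈ (M⊆Fb x∈M) x<A))

  d-S′≡d-S : ∀ {A} → A ∈ H′ ∪ Fb → d L S′ (H′ ↓< A) A ≡ d L S (H′ ↓< A) A
  d-S′≡d-S {A} A∈ = d-cong (≤-antisym
    (⋁-least _ λ x∈ → [ ⋁-upper _ ∘ p⊆p∪q _ , below-S′ ∘ ∈↓<⁻ ]′ (x∈p∪q⁻ _ _ x∈))
    (⋁-least _ λ y∈ → [ ⋁-upper _ ∘ p⊆p∪q _ , below-S ∘ ∈↓<⁻ ]′ (x∈p∪q⁻ _ _ y∈)))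
    where
    below-S′ : ∀ {x} → x ∈ S′ × x < A → x ≤ ⋁ L ((H′ ↓< A) ∪ (S ↓< A))
    below-S′ (x∈S′ , x<A) with x∈p∪q⁻ (S ─ ⁅ b ⁆) Fb x∈S′
    ... | inj₁ x∈S─b = ∈↓<-≤⋁ (p─q⊆p S ⁅ b ⁆ x∈S─b) x<A
    ... | inj₂ x∈Fb  = ≤-trans (proj₁ (Fb<b x∈Fb)) (∈↓<-≤⋁ b∈S (factor-below⇒b< A∈ x∈Fb x<A))
    below-S : ∀ {y} → y ∈ S × y < A → y ≤ ⋁ L ((H′ ↓< A) ∪ (S′ ↓< A))
    below-S {y} (y∈S , y<A) with y ≟ b
    ... | no y≢b   = ∈↓<-≤⋁ (p⊆p∪q Fb (x∈p∧x∉q⇒x∈p─q y∈S (x≢y⇒x∉⁅y⁆ y≢b))) y<A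
    ... | yes refl = ≤-trans (G₁.≤⋁factors b≢𝟘)
                       (⋁-least Fb λ g∈Fb → ∈↓<-≤⋁ (q⊆p∪q _ _ g∈Fb) (<-trans (Fb<b g∈Fb) y<A))

  D : Subset n
  D = Fb ─ (S ∪ M)

  ∈D⁻ : ∀ {F} → F ∈ D → F ∈ Fb × F ∉ S × F ∉ M
  ∈D⁻ F∈D = p─q⊆p Fb _ F∈D , F∉S∪M ∘ p⊆p∪q M , F∉S∪M ∘ q⊆p∪q S M
    where F∉S∪M = x∈p─q⇒x∉q Fb (S ∪ M) F∈D

  Base : Subset n
  Base = ((H′ ∪ M) ↓< b) ∪ (S ↓< b)

  Base⊆G₁ : ∀ {x} → x ∈ Base → x ∈ G₁ × x < b
  Base⊆G₁ x∈ with x∈p∪q⁻ _ _ x∈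
  ... | inj₁ x∈H′M↓b = let x∈H′M , x<b = ∈↓<⁻ x∈H′M↓b in
    [ H′⊆G₁ , Fb⊆G₁ ∘ M⊆Fb ]′ (x∈p∪q⁻ H′ M x∈H′M) , x<b
  ... | inj₂ x∈S↓b = let x∈S , x<b = ∈↓<⁻ x∈S↓b in
    [ id , ⊥-elim ∘ proj₂ x<b ∘ x∈⁅y⁆⇒x≡y b ]′ (x∈p∪q⁻ G₁ ⁅ b ⁆ (proj₁ S-nested x∈S)) , x<b

  Base-below-D : ∀ {F x} → F ∈ D → x ∈ Base → x ≤ F → x ∈ (H′ ↓< F) ∪ (S′ ↓< F)
  Base-below-D {F} {x} F∈D x∈ x≤F with ∈D⁻ F∈D | x∈p∪q⁻ _ _ x∈
  ... | F∈Fb , F∉S , F∉M | inj₁ x∈H′M↓b with x∈p∪q⁻ H′ M (proj₁ (∈↓<⁻ x∈H′M↓b))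
  ...   | inj₁ x∈H′ = p⊆p∪q _ (∈↓<⁺ x∈H′ (x≤F , λ { refl → H′∩Fb=∅ (x , x∈p∩q⁺ (x∈H′ , F∈Fb)) }))
  ...   | inj₂ x∈M  = ⊥-elim (Fb-antichain (M⊆Fb x∈M) F∈Fb (x≤F , λ { refl → F∉M x∈M }))
  Base-below-D {F} {x} F∈D x∈ x≤F | F∈Fb , F∉S , F∉M | inj₂ x∈S↓b =
    let x∈S , x<b = ∈↓<⁻ x∈S↓b in
    q⊆p∪q _ _ (∈↓<⁺ (p⊆p∪q Fb (x∈p∧x∉q⇒x∈p─q x∈S (x≢y⇒x∉⁅y⁆ (proj₂ x<b))))
                    (x≤F , λ { refl → F∉S x∈S }))

  d-b≤∑d′ : d L S ((H′ ∪ M) ↓< b) b ≤ℕ sumOver L D (λ F → d L S′ (H′ ↓< F) F)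
  d-b≤∑d′ = begin
    d L S ((H′ ∪ M) ↓< b) b                  ≤⟨ d≤∣T∣ (U-atoms , ≤-antisym b≤⋁W ⋁W≤b) ⟩
    ∣ U ∣                                      ≤⟨ ∣⋃-map∣≤sum T⋆ (elements D) ⟩
    sum (map (∣_∣ ∘ T⋆) (elements D))          ≡⟨ cong sum (map-cong (size ∘ optimal) (elements D)) ⟩
    sumOver L D (λ F → d L S′ (H′ ↓< F) F)     ∎
    where
    open ℕ.≤-Reasoning
    open OptimalCompletion
    optimal : ∀ F → OptimalCompletion S′ (H′ ↓< F) F
    optimal F = d-attained atomic ↓<-bounded
    T⋆ : Fin n → Subset n
    T⋆ = set ∘ optimal
    U : Subset n
    U = ⋃ (map T⋆ (elements D))
    W = Base ∪ U

    U-atoms : ∀ a → a ∈ U → IsAtom L a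
    U-atoms a a∈U = let F , _ , a∈T⋆F = ∈⋃-map⁻ T⋆ (elements D) a∈U in atoms (optimal F) a a∈T⋆F

    ⋁W≤b : ⋁ L W ≤ b
    ⋁W≤b = ⋁-least W λ x∈ → [ proj₁ ∘ proj₂ ∘ Base⊆G₁ , U≤b ]′ (x∈p∪q⁻ Base U x∈)
      where
      U≤b : ∀ {a} → a ∈ U → a ≤ b
      U≤b a∈U with ∈⋃-map⁻ T⋆ (elements D) a∈U
      ... | F , F∈ , a∈T⋆F =
        ≤-trans (subst (_ ≤_) (sym (joins (optimal F))) (⋁-upper _ (q⊆p∪q _ _ a∈T⋆F)))
                (proj₁ (Fb<b (proj₁ (∈D⁻ (∈-elements⁻ F∈)))))

    b≤⋁W : b ≤ ⋁ L W
    b≤⋁W = ≤-trans (G₁.≤⋁factors b≢𝟘) (⋁-least Fb factor≤⋁W)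
      where
      factor≤⋁W : ∀ {g} → g ∈ Fb → g ≤ ⋁ L W
      factor≤⋁W {g} g∈Fb with g ∈? S | g ∈? M
      ... | yes g∈S | _       = ⋁-upper W (p⊆p∪q U (q⊆p∪q _ _ (∈↓<⁺ g∈S (Fb<b g∈Fb))))
      ... | no _    | yes g∈M = ⋁-upper W (p⊆p∪q U (p⊆p∪q _ (∈↓<⁺ (q⊆p∪q H′ M g∈M) (Fb<b g∈Fb))))
      ... | no g∉S  | no g∉M  = subst (_≤ ⋁ L W) (sym (joins (optimal g)))
        (⋁-least _ λ x∈ → [ generator , ⋁-upper W ∘ q⊆p∪q Base U ∘ ∈⋃-map⁺ T⋆ (∈-elements⁺ g∈D) ]′
                            (x∈p∪q⁻ _ _ x∈))
        where
        g∈D : g ∈ D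
        g∈D = x∈p∧x∉q⇒x∈p─q g∈Fb ([ g∉S , g∉M ]′ ∘ x∈p∪q⁻ S M)
        generator : ∀ {x} → x ∈ (H′ ↓< g) ∪ (S′ ↓< g) → x ≤ ⋁ L W
        generator x∈ with x∈p∪q⁻ _ _ x∈
        ... | inj₁ x∈H′↓g = let x∈H′ , x<g = ∈↓<⁻ x∈H′↓g in
          ⋁-upper W (p⊆p∪q U (p⊆p∪q _ (∈↓<⁺ (p⊆p∪q M x∈H′) (<-trans x<g (Fb<b g∈Fb)))))
        ... | inj₂ x∈S′↓g with ∈↓<⁻ x∈S′↓g
        ...   | x∈S′ , x<g with x∈p∪q⁻ (S ─ ⁅ b ⁆) Fb x∈S′
        ...     | inj₁ x∈S─b = ⋁-upper W (p⊆p∪q U (q⊆p∪q _ _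
                                 (∈↓<⁺ (p─q⊆p S ⁅ b ⁆ x∈S─b) (<-trans x<g (Fb<b g∈Fb)))))
        ...     | inj₂ x∈Fb  = ⊥-elim (Fb-antichain x∈Fb g∈Fb x<g)

  ∑d′≤d-b : sumOver L D (λ F → d L S′ (H′ ↓< F) F) ≤ℕ d L S ((H′ ∪ M) ↓< b) b
  ∑d′≤d-b = begin
    sumOver L D (λ F → d L S′ (H′ ↓< F) F)   ≤⟨ sum-map-mono (elements D)
                                                  (d≤∣T∣ ∘ restriction-completes ∘ ∈-elements⁻) ⟩
    sum (map (∣_∣ ∘ (T₀ ↓≤_)) (elements D))  ≡⟨ ∣⋃-map∣≡sum (T₀ ↓≤_) (elements-unique D)
                                                  restrictions-disjoint ⟨
    ∣ ⋃ (map (T₀ ↓≤_) (elements D)) ∣        ≤⟨ p⊆q⇒∣p∣≤∣q∣ ⋃restrictions⊆T₀ ⟩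
    ∣ T₀ ∣                                    ≡⟨ optimal.size ⟩
    d L S ((H′ ∪ M) ↓< b) b                   ∎
    where
    open ℕ.≤-Reasoning
    module optimal = OptimalCompletion (d-attained atomic {S} {(H′ ∪ M) ↓< b} {b} ↓<-bounded)
    T₀ = optimal.set

    generators : ∀ {x} → x ∈ Base ∪ T₀ → x ∈ G₁ × x ≤ b
    generators x∈ with x∈p∪q⁻ Base T₀ x∈
    ... | inj₁ x∈Base = proj₁ (Base⊆G₁ x∈Base) , proj₁ (proj₂ (Base⊆G₁ x∈Base))
    ... | inj₂ x∈T₀   = G₁.atom∈G (optimal.atoms _ x∈T₀) , subst (_ ≤_) (sym optimal.joins) (⋁-upper _ x∈)

    restriction-completes : ∀ {F} → F ∈ D → Completes S′ (H′ ↓< F) F (T₀ ↓≤ F)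
    restriction-completes {F} F∈D =
      (λ a → optimal.atoms a ∘ proj₁ ∘ ∈↓≤⁻) ,
      ≤-antisym (G₁.factor≤ b≢𝟘 (Base ∪ T₀) generators (≤-reflexive optimal.joins)
                             (proj₁ (∈D⁻ F∈D)) ⋁≤F below-F)
                ⋁≤F
      where
      Y = ((H′ ↓< F) ∪ (S′ ↓< F)) ∪ (T₀ ↓≤ F)
      ⋁≤F : ⋁ L Y ≤ F
      ⋁≤F = ⋁-least Y λ y∈ → [ ↓<-bounded , proj₂ ∘ ∈↓≤⁻ ]′ (x∈p∪q⁻ _ _ y∈)
      below-F : ∀ {x} → x ∈ Base ∪ T₀ → x ≤ F → x ≤ ⋁ L Y
      below-F x∈ x≤F = ⋁-upper Y ([ (λ x∈Base → p⊆p∪q _ (Base-below-D F∈D x∈Base x≤F))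
                                  , (λ x∈T₀ → q⊆p∪q _ _ (∈↓≤⁺ x∈T₀ x≤F)) ]′ (x∈p∪q⁻ Base T₀ x∈))

    restrictions-disjoint : ∀ {F F′} → F ∈ₗ elements D → F′ ∈ₗ elements D → F ≢ F′ →
                            Empty ((T₀ ↓≤ F) ∩ (T₀ ↓≤ F′))
    restrictions-disjoint F∈ F′∈ F≢F′ (a , a∈) with x∈p∩q⁻ (T₀ ↓≤ _) (T₀ ↓≤ _) a∈
    ... | a∈T₀↓F , a∈T₀↓F′ = proj₂ (proj₁ (optimal.atoms a (proj₁ (∈↓≤⁻ a∈T₀↓F))))
      (sym (G₁.factors-meet-in-𝟘 b≢𝟘 (proj₁ (∈D⁻ (∈-elements⁻ F∈))) (proj₁ (∈D⁻ (∈-elements⁻ F′∈)))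
                                  F≢F′ (proj₂ (∈↓≤⁻ a∈T₀↓F)) (proj₂ (∈↓≤⁻ a∈T₀↓F′))))

    ⋃restrictions⊆T₀ : ⋃ (map (T₀ ↓≤_) (elements D)) ⊆ T₀
    ⋃restrictions⊆T₀ a∈ = let _ , _ , a∈T₀↓F = ∈⋃-map⁻ (T₀ ↓≤_) (elements D) a∈ in
      proj₁ (∈↓≤⁻ a∈T₀↓F)

  d-b≡∑d′ : d L S ((H′ ∪ M) ↓< b) b ≡ sumOver L D (λ F → d L S′ (H′ ↓< F) F)
  d-b≡∑d′ = ℕ.≤-antisym d-b≤∑d′ ∑d′≤d-b

  ∑d′≡∑d : sumOver L D (λ F → d L S′ (H′ ↓< F) F) ≡ sumOver L D (λ F → d L S (H′ ↓< F) F)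
  ∑d′≡∑d = cong sum (map-cong-local (All.tabulate
    (d-S′≡d-S ∘ q⊆p∪q H′ Fb ∘ proj₁ ∘ ∈D⁻ ∘ ∈-elements⁻)))

  ⁅b⁆⊆S : ⁅ b ⁆ ⊆ S
  ⁅b⁆⊆S x∈⁅b⁆ = subst (_∈ S) (sym (x∈⁅y⁆⇒x≡y b x∈⁅b⁆)) b∈S

  M⊆S′ : M ⊆ S′
  M⊆S′ = q⊆p∪q _ _ ∘ M⊆Fb

open Defs using (_↓<_)

lemma4 : (L : FinLattice) → Ranked L → Atomic L →
  (G₁ : Subset (FinLattice.n L)) (b : Fin (FinLattice.n L)) → b ∉ G₁ →
  IsBuildingSet L G₁ → IsBuildingSet L (G₁ ∪ ⁅ b ⁆) →
  (S : Subset (FinLattice.n L)) → Nested L (G₁ ∪ ⁅ b ⁆) S → b ∈ S →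
  (H' M : Subset (FinLattice.n L)) → H' ⊆ G₁ → M ⊆ F L G₁ b →
  Empty (H' ∩ F L G₁ b) → Nested L (G₁ ∪ ⁅ b ⁆) ((H' ∪ M) ∪ S) →
  let Fb = F L G₁ b
      S' = (S ─ ⁅ b ⁆) ∪ Fb
      _<↓_ = _↓<_ L
  in (∀ A → A ∈ (H' ∪ Fb) →
        (d L S ((H' ∪ M) <↓ A) A ≡ d L S (H' <↓ A) A)
      × (d L S (((H' ∪ M) ∪ ⁅ b ⁆) <↓ A) A ≡ d L S ((H' ∪ M) <↓ A) A)
      × (d L S' ((H' ∪ M) <↓ A) A ≡ d L S' (H' <↓ A) A)
      × (d L S' (H' <↓ A) A ≡ d L S (H' <↓ A) A))
   × (d L S ((H' ∪ M) <↓ b) b ≡ sumOver L (Fb ─ (S ∪ M)) (λ F′ → d L S' (H' <↓ F′) F′))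
   × (sumOver L (Fb ─ (S ∪ M)) (λ F′ → d L S' (H' <↓ F′) F′)
        ≡ sumOver L (Fb ─ (S ∪ M)) (λ F′ → d L S (H' <↓ F′) F′))
lemma4 L _ atomic G₁ b b∉G₁ building₁ building₂ S S-nested b∈S H′ M H′⊆G₁ M⊆Fb H′∩Fb=∅ H′MS-nested =
  (λ A A∈ → d-H′∪M≡d-H′ A∈ , d-∪-⊆ ⁅b⁆⊆S , d-∪-⊆ M⊆S′ , d-S′≡d-S A∈) , d-b≡∑d′ , ∑d′≡∑d
  where
  open FinLatticeProperties L using (d-∪-⊆)
  open BuildingSetExtension L atomic G₁ b b∉G₁ building₁ building₂ S S-nested b∈S
                            H′ M H′⊆G₁ M⊆Fb H′∩Fb=∅ H′MS-nested
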